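{- Let $n\ge 1$, let $A\in\mathcal S(K_n)$, let $D_\mu=\mathrm{diag}(\mu_1,\dots,\mu_n)$ and $D_\lambda=\mathrm{diag}(\lambda_1,\dots,\lambda_n)$ with $\mu_i\neq 0$ for all $i$, and let $$B=\begin{bmatrix}A & D_\mu\\ D_\mu & D_\lambda\end{bmatrix}\in\mathcal S(K_n\circ K_1).$$ If $D_\lambda=\lambda I_n$ for some real $\lambda$ and $\mu_i\neq\pm\mu_j$ for all $i\ne j$ in $\{1,\dots,n\}$, then $B$ has the Strong Spectral Property.
   Context: $K_n\circ K_1$ (the corona of $K_n$) is the graph on $\{1,\dots,2n\}$ consisting of a complete graph on $\{1,\dots,n\}$ with a pendant vertex $n+i$ attached to each vertex $i$. For a graph $G$ on $\{1,\dots,N\}$, $\mathcal S(G)$ is the set of real symmetric $N\times N$ matrices whose $(i,j)$ entry ($i\neq j$) is nonzero iff $ij\in E(G)$. A real symmetric matrix $B$ has the Strong Spectral Property (SSP) if the only real symmetric $X$ with $B\circ X=O$ (entrywise product), $I\circ X=O$ and $BX=XB$ is $X=O$. -}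

module Defs where

open import Level using (Level)
open import Data.Nat using (ℕ; zero; suc) renaming (_+_ to _+ℕ_)
open import Data.Unit.Polymorphic using (⊤)
open import Data.Fin using (Fin; zero; suc; splitAt; _≟_)
open import Data.Sum using (_⊎_; inj₁; inj₂)
open import Data.Bool using (Bool; true; false; not; if_then_else_)
open import Data.Product using (_×_)
open import Relation.Nullary using (does)
open import Algebra.Apartness.Bundles using (HeytingField)

-- A simple graph on the vertex set Fin N, given by its (decidable) adjacency
-- predicate.  Only off-diagonal values are ever consulted.
Graph : ℕ → Set
Graph N = Fin N → Fin N → Bool

K : (n : ℕ) → Graph n
K n i j = not (does (i ≟ j))

-- The corona K_n ∘ K_1 on Fin (n +ℕ n): vertices inj₁ i (via splitAt) are the
-- clique vertices 1..n, vertices inj₂ i are the pendant vertices n+1..2n,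
-- pendant n+i being attached to i.
coronaAdj : (n : ℕ) → Fin n ⊎ Fin n → Fin n ⊎ Fin n → Bool
coronaAdj n (inj₁ i) (inj₁ j) = not (does (i ≟ j))
coronaAdj n (inj₁ i) (inj₂ j) = does (i ≟ j)
coronaAdj n (inj₂ i) (inj₁ j) = does (i ≟ j)
coronaAdj n (inj₂ i) (inj₂ j) = false

corona : (n : ℕ) → Graph (n +ℕ n)
corona n i j = coronaAdj n (splitAt n i) (splitAt n j)

-- Linear algebra over a Heyting field F (the constructive notion of field;
-- the real numbers are the intended model).  "Nonzero" is apartness from 0.
module Matrices {c ℓ₁ ℓ₂ : Level} (F : HeytingField c ℓ₁ ℓ₂) where
  open HeytingField F using (Carrier; _≈_; _#_; _+_; _*_; -_; 0#; 1#)

  Matrix : ℕ → Set c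
  Matrix N = Fin N → Fin N → Carrier

  sumF : {N : ℕ} → (Fin N → Carrier) → Carrier
  sumF {zero}  f = 0#
  sumF {suc N} f = f zero + sumF {N} (λ i → f (suc i))

  _·_ : {N : ℕ} → Matrix N → Matrix N → Matrix N
  (M · P) i k = sumF (λ j → M i j * P j k)

  _∘ₕ_ : {N : ℕ} → Matrix N → Matrix N → Matrix N
  (M ∘ₕ P) i j = M i j * P i j

  I : {N : ℕ} → Matrix N
  I i j = if does (i ≟ j) then 1# else 0#

  O : {N : ℕ} → Matrix N
  O i j = 0#

  _≈ₘ_ : {N : ℕ} → Matrix N → Matrix N → Set ℓ₁
  M ≈ₘ P = ∀ i j → M i j ≈ P i j

  Symmetric : {N : ℕ} → Matrix N → Set ℓ₁
  Symmetric M = ∀ i j → M i j ≈ M j i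

  diag : {n : ℕ} → (Fin n → Carrier) → Matrix n
  diag d i j = if does (i ≟ j) then d i else 0#

  OffDiagPattern : {N : ℕ} → Graph N → Matrix N → Fin N → Fin N → Set (ℓ₁ Level.⊔ ℓ₂)
  OffDiagPattern {N} G M i j with does (i ≟ j) | G i j
  ... | true  | _     = ⊤
  ... | false | true  = Level.Lift ℓ₁ (M i j # 0#)
  ... | false | false = Level.Lift ℓ₂ (M i j ≈ 0#)

  InS : {N : ℕ} → Graph N → Matrix N → Set (ℓ₁ Level.⊔ ℓ₂)
  InS G M = Symmetric M × (∀ i j → OffDiagPattern G M i j)

  SSP : {N : ℕ} → Matrix N → Set (c Level.⊔ ℓ₁)
  SSP {N} B = (X : Matrix N) → Symmetric X → (B ∘ₕ X) ≈ₘ O → (I ∘ₕ X) ≈ₘ O →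
              (B · X) ≈ₘ (X · B) → X ≈ₘ O

  block : {n : ℕ} → Matrix n → Matrix n → Matrix n → Matrix n → Matrix (n +ℕ n)
  block {n} P Q R T i j with splitAt n i | splitAt n j
  ... | inj₁ a | inj₁ b = P a b
  ... | inj₁ a | inj₂ b = Q a b
  ... | inj₂ a | inj₁ b = R a b
  ... | inj₂ a | inj₂ b = T a b

{-# OPTIONS --safe #-}
module Submission where

open import Defs
open import Level using (Level; lift)
open import Data.Nat using (ℕ; _≤_; zero; suc) renaming (_+_ to _+ℕ_)
open import Data.Fin using (Fin; zero; suc; _↑ˡ_; _↑ʳ_; splitAt; join; _≟_)
open import Data.Fin.Properties using (suc-injective; splitAt-↑ˡ; splitAt-↑ʳ; join-splitAt)
open import Data.Product using (Σ; _×_; _,_; proj₁; proj₂)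
open import Data.Sum using (inj₁; inj₂)
open import Data.Empty using (⊥-elim)
open import Function using (_∘_)
open import Relation.Nullary using (¬_; yes; no)
open import Relation.Binary.PropositionalEquality as ≡ using (_≡_; _≢_; subst)
open import Algebra.Apartness.Bundles using (HeytingField; HeytingCommutativeRing)
open import Algebra.Bundles using (CommutativeRing)

-- Write X in blocks [[X₁, Y], [Yᵀ, Z]].  The zero pattern B ∘ X = O kills X₁ and
-- the diagonal of Y.  The (1,1) and (2,2) blocks of BX = XB, using X₁ = O and
-- D_λ = λI, give μᵢ Yⱼᵢ = Yᵢⱼ μⱼ and μᵢ Yᵢⱼ = Yⱼᵢ μⱼ, hence (μᵢ² − μⱼ²) Yⱼᵢ = 0,
-- so Y = O as μᵢ ≠ ±μⱼ.  The (1,2) block then reduces to D_μ Z = O, so Z = O.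

∀-↑ : ∀ {ℓ} m n {P : Fin (m +ℕ n) → Set ℓ} →
      (∀ i → P (i ↑ˡ n)) → (∀ j → P (m ↑ʳ j)) → ∀ a → P a
∀-↑ m n {P} left right a = subst P (join-splitAt m n a) (on-parts (splitAt m a))
  where
  on-parts : ∀ s → P (join m n s)
  on-parts (inj₁ i) = left i
  on-parts (inj₂ j) = right j

module CoronaSSP {c ℓ₁ ℓ₂ : Level} (F : HeytingField c ℓ₁ ℓ₂) where
  open HeytingField F hiding (zero)
  open Matrices F
  open HeytingCommutativeRing heytingCommutativeRing using (commutativeRing)
  open CommutativeRing commutativeRing using (ring; +-abelianGroup; *-commutativeSemigroup)
  open import Algebra.Apartness.Properties.HeytingCommutativeRing heytingCommutativeRing using (x-0≈x)
  open import Algebra.Properties.Ring ring using (-‿involutive; -‿distribˡ-*)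
  open import Algebra.Properties.CommutativeSemigroup *-commutativeSemigroup using (x∙yz≈y∙xz)
  open import Algebra.Properties.AbelianGroup +-abelianGroup using (∙-cancelʳ)
  open import Relation.Binary.Reasoning.Setoid setoid

  ≡⇒≈ : ∀ {x y} → x ≡ y → x ≈ y
  ≡⇒≈ ≡.refl = refl

  x#y→[x-y]z≈0→z≈0 : ∀ {x y z} → x # y → (x - y) * z ≈ 0# → z ≈ 0#
  x#y→[x-y]z≈0→z≈0 {x} {y} {z} x#y [x-y]z≈0 with #⇒invertible x#y
  ... | w , w[x-y]≈1 , _ = begin
    z                  ≈⟨ *-identityˡ z ⟨
    1# * z             ≈⟨ *-congʳ w[x-y]≈1 ⟨
    w * (x - y) * z    ≈⟨ *-assoc w (x - y) z ⟩
    w * ((x - y) * z)  ≈⟨ *-congˡ [x-y]z≈0 ⟩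
    w * 0#             ≈⟨ zeroʳ w ⟩
    0#                 ∎

  x#0→xz≈0→z≈0 : ∀ {x z} → x # 0# → x * z ≈ 0# → z ≈ 0#
  x#0→xz≈0→z≈0 {x} x#0 xz≈0 = x#y→[x-y]z≈0→z≈0 x#0 (trans (*-congʳ (x-0≈x x)) xz≈0)

  x#y→xz≈yz→z≈0 : ∀ {x y z} → x # y → x * z ≈ y * z → z ≈ 0#
  x#y→xz≈yz→z≈0 {x} {y} {z} x#y xz≈yz = x#y→[x-y]z≈0→z≈0 x#y (begin
    (x - y) * z        ≈⟨ distribʳ z x (- y) ⟩
    x * z + - y * z    ≈⟨ +-congˡ (-‿distribˡ-* y z) ⟨
    x * z - y * z      ≈⟨ +-congʳ xz≈yz ⟩
    y * z - y * z      ≈⟨ -‿inverseʳ (y * z) ⟩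
    0#                 ∎)

  x²z≈y²z→z≈0 : ∀ {x y z} → x # y → x # (- y) → x * (x * z) ≈ y * (y * z) → z ≈ 0#
  x²z≈y²z→z≈0 {x} {y} {z} x#y x#-y x²z≈y²z =
    x#y→[x-y]z≈0→z≈0 x#-y (x#y→xz≈yz→z≈0 x#y x[x+y]z≈y[x+y]z)
    where
    w = (x - - y) * z
    w≈xz+yz : w ≈ x * z + y * z
    w≈xz+yz = trans (*-congʳ (+-congˡ (-‿involutive y))) (distribʳ z x y)
    x[x+y]z≈y[x+y]z : x * w ≈ y * w
    x[x+y]z≈y[x+y]z = begin
      x * w                        ≈⟨ *-congˡ w≈xz+yz ⟩
      x * (x * z + y * z)          ≈⟨ distribˡ x (x * z) (y * z) ⟩
      x * (x * z) + x * (y * z)    ≈⟨ +-cong x²z≈y²z (x∙yz≈y∙xz x y z) ⟩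
      y * (y * z) + y * (x * z)    ≈⟨ +-comm _ _ ⟩
      y * (x * z) + y * (y * z)    ≈⟨ distribˡ y (x * z) (y * z) ⟨
      y * (x * z + y * z)          ≈⟨ *-congˡ w≈xz+yz ⟨
      y * w                        ∎

  square-balance : ∀ {u v a b} → u * b ≈ a * v → u * a ≈ b * v → u * (u * b) ≈ v * (v * b)
  square-balance {u} {v} {a} {b} ub≈av ua≈bv = begin
    u * (u * b)    ≈⟨ *-congˡ ub≈av ⟩
    u * (a * v)    ≈⟨ *-assoc u a v ⟨
    u * a * v      ≈⟨ *-congʳ ua≈bv ⟩
    b * v * v      ≈⟨ *-comm (b * v) v ⟩
    v * (b * v)    ≈⟨ *-congˡ (*-comm b v) ⟩
    v * (v * b)    ∎

  sumF-cong : ∀ {N} {f g : Fin N → Carrier} → (∀ k → f k ≈ g k) → sumF f ≈ sumF g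
  sumF-cong {zero}  f≈g = refl
  sumF-cong {suc N} f≈g = +-cong (f≈g zero) (sumF-cong (λ k → f≈g (suc k)))

  sumF-zero : ∀ {N} {f : Fin N → Carrier} → (∀ k → f k ≈ 0#) → sumF f ≈ 0#
  sumF-zero {zero}  f≈0 = refl
  sumF-zero {suc N} f≈0 = trans (+-cong (f≈0 zero) (sumF-zero (λ k → f≈0 (suc k)))) (+-identityˡ 0#)

  sumF-supported : ∀ {N} {f : Fin N → Carrier} i → (∀ k → i ≢ k → f k ≈ 0#) → sumF f ≈ f i
  sumF-supported zero    f≈0 =
    trans (+-congˡ (sumF-zero (λ k → f≈0 (suc k) λ ()))) (+-identityʳ _)
  sumF-supported (suc i) f≈0 =
    trans (+-cong (f≈0 zero λ ()) (sumF-supported i (λ k i≢k → f≈0 (suc k) (i≢k ∘ suc-injective))))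
          (+-identityˡ _)

  sumF-split : ∀ m {p} (f : Fin (m +ℕ p) → Carrier) →
               sumF f ≈ sumF (λ k → f (k ↑ˡ p)) + sumF (λ k → f (m ↑ʳ k))
  sumF-split zero    f = sym (+-identityˡ _)
  sumF-split (suc m) f = trans (+-congˡ (sumF-split m (λ k → f (suc k)))) (sym (+-assoc _ _ _))

  diag-≡ : ∀ {n} (d : Fin n → Carrier) i → diag d i i ≡ d i
  diag-≡ d i with i ≟ i
  ... | yes _   = ≡.refl
  ... | no i≢i  = ⊥-elim (i≢i ≡.refl)

  diag-≢ : ∀ {n} (d : Fin n → Carrier) {i j} → i ≢ j → diag d i j ≡ 0#
  diag-≢ d {i} {j} i≢j with i ≟ j
  ... | yes i≡j = ⊥-elim (i≢j i≡j)
  ... | no _    = ≡.refl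

  sumF-diagˡ : ∀ {n} (d : Fin n → Carrier) i (g : Fin n → Carrier) →
               sumF (λ k → diag d i k * g k) ≈ d i * g i
  sumF-diagˡ d i g =
    trans (sumF-supported i (λ k i≢k → trans (*-congʳ (≡⇒≈ (diag-≢ d i≢k))) (zeroˡ _)))
          (*-congʳ (≡⇒≈ (diag-≡ d i)))

  sumF-diagʳ : ∀ {n} (d : Fin n → Carrier) j (g : Fin n → Carrier) →
               sumF (λ k → g k * diag d k j) ≈ g j * d j
  sumF-diagʳ d j g =
    trans (sumF-supported j (λ k j≢k → trans (*-congˡ (≡⇒≈ (diag-≢ d (j≢k ∘ ≡.sym)))) (zeroʳ _)))
          (*-congˡ (≡⇒≈ (diag-≡ d j)))

  InS-K⇒offDiag#0 : ∀ {n} {A : Matrix n} → InS (K n) A → ∀ i j → i ≢ j → A i j # 0#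
  InS-K⇒offDiag#0 (_ , A-pattern) i j i≢j with i ≟ j | A-pattern i j
  ... | yes i≡j | _ = ⊥-elim (i≢j i≡j)
  ... | no _    | lift Aij#0 = Aij#0

  diag≈scalar⇒constant : ∀ {n} {d : Fin n → Carrier} {s} →
                         diag d ≈ₘ (λ i j → s * I i j) → ∀ i j → d i ≈ d j
  diag≈scalar⇒constant {d = d} {s} d≈sI i j = trans (d≈s i) (sym (d≈s j))
    where
    d≈s : ∀ i → d i ≈ s
    d≈s i = begin
      d i                         ≡⟨ diag-≡ d i ⟨
      diag d i i                  ≈⟨ d≈sI i i ⟩
      s * diag (λ _ → 1#) i i     ≡⟨ ≡.cong (s *_) (diag-≡ (λ _ → 1#) i) ⟩
      s * 1#                      ≈⟨ *-identityʳ s ⟩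
      s                           ∎

  module _ {n : ℕ} (P Q R T : Matrix n) where
    block-↑ˡ-↑ˡ : ∀ i j → block P Q R T (i ↑ˡ n) (j ↑ˡ n) ≡ P i j
    block-↑ˡ-↑ˡ i j rewrite splitAt-↑ˡ n i n | splitAt-↑ˡ n j n = ≡.refl

    block-↑ˡ-↑ʳ : ∀ i j → block P Q R T (i ↑ˡ n) (n ↑ʳ j) ≡ Q i j
    block-↑ˡ-↑ʳ i j rewrite splitAt-↑ˡ n i n | splitAt-↑ʳ n n j = ≡.refl

    block-↑ʳ-↑ˡ : ∀ i j → block P Q R T (n ↑ʳ i) (j ↑ˡ n) ≡ R i j
    block-↑ʳ-↑ˡ i j rewrite splitAt-↑ʳ n n i | splitAt-↑ˡ n j n = ≡.refl

    block-↑ʳ-↑ʳ : ∀ i j → block P Q R T (n ↑ʳ i) (n ↑ʳ j) ≡ T i j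
    block-↑ʳ-↑ʳ i j rewrite splitAt-↑ʳ n n i | splitAt-↑ʳ n n j = ≡.refl

  module _ {n : ℕ} (P : Matrix n) (q r t : Fin n → Carrier) (X : Matrix (n +ℕ n)) where
    private
      B : Matrix (n +ℕ n)
      B = block P (diag q) (diag r) (diag t)

    block·-↑ˡ : ∀ i b → (B · X) (i ↑ˡ n) b ≈ sumF (λ k → P i k * X (k ↑ˡ n) b) + q i * X (n ↑ʳ i) b
    block·-↑ˡ i b = trans (sumF-split n _) (+-cong
      (sumF-cong λ k → *-congʳ (≡⇒≈ (block-↑ˡ-↑ˡ P _ _ _ i k)))
      (trans (sumF-cong λ k → *-congʳ (≡⇒≈ (block-↑ˡ-↑ʳ P _ _ _ i k))) (sumF-diagˡ q i _)))

    block·-↑ʳ : ∀ i b → (B · X) (n ↑ʳ i) b ≈ r i * X (i ↑ˡ n) b + t i * X (n ↑ʳ i) b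
    block·-↑ʳ i b = trans (sumF-split n _) (+-cong
      (trans (sumF-cong λ k → *-congʳ (≡⇒≈ (block-↑ʳ-↑ˡ P _ _ _ i k))) (sumF-diagˡ r i _))
      (trans (sumF-cong λ k → *-congʳ (≡⇒≈ (block-↑ʳ-↑ʳ P _ _ _ i k))) (sumF-diagˡ t i _)))

    ·block-↑ˡ : ∀ a j → (X · B) a (j ↑ˡ n) ≈ sumF (λ k → X a (k ↑ˡ n) * P k j) + X a (n ↑ʳ j) * r j
    ·block-↑ˡ a j = trans (sumF-split n _) (+-cong
      (sumF-cong λ k → *-congˡ (≡⇒≈ (block-↑ˡ-↑ˡ P _ _ _ k j)))
      (trans (sumF-cong λ k → *-congˡ (≡⇒≈ (block-↑ʳ-↑ˡ P _ _ _ k j))) (sumF-diagʳ r j _)))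

    ·block-↑ʳ : ∀ a j → (X · B) a (n ↑ʳ j) ≈ X a (j ↑ˡ n) * q j + X a (n ↑ʳ j) * t j
    ·block-↑ʳ a j = trans (sumF-split n _) (+-cong
      (trans (sumF-cong λ k → *-congˡ (≡⇒≈ (block-↑ˡ-↑ʳ P _ _ _ k j))) (sumF-diagʳ q j _))
      (trans (sumF-cong λ k → *-congˡ (≡⇒≈ (block-↑ʳ-↑ʳ P _ _ _ k j))) (sumF-diagʳ t j _)))

  module _ {n : ℕ} (A : Matrix n) (μ λs : Fin n → Carrier)
           (A-offDiag : ∀ i j → i ≢ j → A i j # 0#)
           (μ#0 : ∀ i → μ i # 0#)
           (λs-constant : ∀ i j → λs i ≈ λs j)
           (μ-apart-± : ∀ i j → i ≢ j → (μ i # μ j) × (μ i # (- μ j))) where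

    private
      B : Matrix (n +ℕ n)
      B = block A (diag μ) (diag μ) (diag λs)

      clique pendant : Fin n → Fin (n +ℕ n)
      clique i  = i ↑ˡ n
      pendant i = n ↑ʳ i

    corona-SSP : SSP B
    corona-SSP X X-sym B∘X≈O I∘X≈O BX≈XB =
      ∀-↑ n n (λ i → ∀-↑ n n (X-clique i) (X-link i))
              (λ i → ∀-↑ n n (λ j → trans (X-sym _ _) (X-link j i)) (X-pendant i))
      where
      X-diag : ∀ p → X p p ≈ 0#
      X-diag p = trans (sym (*-identityˡ _)) (trans (*-congʳ (≡⇒≈ (≡.sym (diag-≡ (λ _ → 1#) p)))) (I∘X≈O p p))

      X-clique : ∀ i j → X (clique i) (clique j) ≈ 0#
      X-clique i j with i ≟ j
      ... | yes ≡.refl = X-diag (clique i)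
      ... | no i≢j     = x#0→xz≈0→z≈0
        (subst (_# 0#) (≡.sym (block-↑ˡ-↑ˡ A _ _ _ i j)) (A-offDiag i j i≢j)) (B∘X≈O _ _)

      X-link-diag : ∀ i → X (clique i) (pendant i) ≈ 0#
      X-link-diag i = x#0→xz≈0→z≈0
        (subst (_# 0#) (≡.sym (≡.trans (block-↑ˡ-↑ʳ A _ _ _ i i) (diag-≡ μ i))) (μ#0 i)) (B∘X≈O _ _)

      Y : Matrix n
      Y i j = X (clique i) (pendant j)

      clique-clique-commutes : ∀ i j → μ i * Y j i ≈ Y i j * μ j
      clique-clique-commutes i j = begin
        μ i * Y j i                                                      ≈⟨ *-congˡ (X-sym _ _) ⟩
        μ i * X (pendant i) (clique j)                                   ≈⟨ +-identityˡ _ ⟨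
        0# + μ i * X (pendant i) (clique j)                              ≈⟨ +-congʳ (sumF-zero λ k → trans (*-congˡ (X-clique k j)) (zeroʳ _)) ⟨
        sumF (λ k → A i k * X (clique k) (clique j)) + μ i * X (pendant i) (clique j) ≈⟨ block·-↑ˡ A μ μ λs X i (clique j) ⟨
        (B · X) (clique i) (clique j)                                    ≈⟨ BX≈XB _ _ ⟩
        (X · B) (clique i) (clique j)                                    ≈⟨ ·block-↑ˡ A μ μ λs X (clique i) j ⟩
        sumF (λ k → X (clique i) (clique k) * A k j) + Y i j * μ j       ≈⟨ +-congʳ (sumF-zero λ k → trans (*-congʳ (X-clique i k)) (zeroˡ _)) ⟩
        0# + Y i j * μ j                                                 ≈⟨ +-identityˡ _ ⟩
        Y i j * μ j                                                      ∎

      pendant-pendant-commutes : ∀ i j → μ i * Y i j ≈ Y j i * μ j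
      pendant-pendant-commutes i j = trans
        (∙-cancelʳ (Z i j * λs j) _ _ (begin
          μ i * Y i j + Z i j * λs j                                     ≈⟨ +-congˡ (trans (*-comm _ _) (*-congʳ (λs-constant j i))) ⟩
          μ i * Y i j + λs i * Z i j                                     ≈⟨ block·-↑ʳ A μ μ λs X i (pendant j) ⟨
          (B · X) (pendant i) (pendant j)                                ≈⟨ BX≈XB _ _ ⟩
          (X · B) (pendant i) (pendant j)                                ≈⟨ ·block-↑ʳ A μ μ λs X (pendant i) j ⟩
          X (pendant i) (clique j) * μ j + Z i j * λs j                  ∎))
        (*-congʳ (X-sym _ _))
        where
        Z : Matrix n
        Z i j = X (pendant i) (pendant j)

      X-link : ∀ i j → X (clique i) (pendant j) ≈ 0#
      X-link i j with i ≟ j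
      ... | yes ≡.refl = X-link-diag i
      ... | no i≢j     = x²z≈y²z→z≈0 μj#μi μj#-μi
        (square-balance (clique-clique-commutes j i) (pendant-pendant-commutes j i))
        where
        μj#μi  = proj₁ (μ-apart-± j i (i≢j ∘ ≡.sym))
        μj#-μi = proj₂ (μ-apart-± j i (i≢j ∘ ≡.sym))

      X-pendant : ∀ i j → X (pendant i) (pendant j) ≈ 0#
      X-pendant i j = x#0→xz≈0→z≈0 (μ#0 i) (begin
        μ i * X (pendant i) (pendant j)                                  ≈⟨ +-identityˡ _ ⟨
        0# + μ i * X (pendant i) (pendant j)                             ≈⟨ +-congʳ (sumF-zero λ k → trans (*-congˡ (X-link k j)) (zeroʳ _)) ⟨
        sumF (λ k → A i k * Y k j) + μ i * X (pendant i) (pendant j)     ≈⟨ block·-↑ˡ A μ μ λs X i (pendant j) ⟨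
        (B · X) (clique i) (pendant j)                                   ≈⟨ BX≈XB _ _ ⟩
        (X · B) (clique i) (pendant j)                                   ≈⟨ ·block-↑ʳ A μ μ λs X (clique i) j ⟩
        X (clique i) (clique j) * μ j + Y i j * λs j                     ≈⟨ +-cong (trans (*-congʳ (X-clique i j)) (zeroˡ _)) (trans (*-congʳ (X-link i j)) (zeroˡ _)) ⟩
        0# + 0#                                                          ≈⟨ +-identityˡ 0# ⟩
        0#                                                               ∎)

mainTheorem13 : {c ℓ₁ ℓ₂ : Level} (F : HeytingField c ℓ₁ ℓ₂) →
    let open HeytingField F in
    let open Matrices F in
    (n : ℕ) → 1 ≤ n →
    (A : Matrix n) → InS (K n) A →
    (μ : Fin n → Carrier) → (λs : Fin n → Carrier) →
    (∀ i → μ i # 0#) →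
    Σ Carrier (λ λ₀ → diag λs ≈ₘ (λ i j → λ₀ * I i j)) →
    (∀ i j → ¬ (i ≡ j) → (μ i # μ j) × (μ i # (- μ j))) →
    SSP (block A (diag μ) (diag μ) (diag λs))
mainTheorem13 F n _ A A∈S μ λs μ#0 (_ , λs≈λ₀I) μ-apart-± =
  corona-SSP A μ λs (InS-K⇒offDiag#0 A∈S) μ#0 (diag≈scalar⇒constant λs≈λ₀I) μ-apart-±
  where open CoronaSSP F
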